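{- Let $\mathcal{P}$ be an LR-vine and let $a,b\in\mathcal{P}$. If $U_a\subseteq U_b$, then $a\le b$. In particular, if $U_a=U_b$, then $a=b$.
   Context: Posets are finite. A graded poset has a rank function $\operatorname{rk}\colon\mathcal{P}\to\mathbb{Z}_{>0}$ with $x<y\Rightarrow\operatorname{rk}(x)<\operatorname{rk}(y)$, $\operatorname{rk}(y)=\operatorname{rk}(x)+1$ when $y$ covers $x$, and minimal elements of rank $1$; $\mathcal{P}_i$ = elements of rank $i$, $\dim(\mathcal{P})$ = number of minimal elements, $\mathcal{E}(v)$ = elements covered by $v$. A vine is a graded poset in which every non-minimal element covers exactly two elements, any two distinct elements of the same rank are covered by at most one common element, and for each $1\le i\le\operatorname{rk}(\mathcal{P})$ the graph $F_i$ on $\mathcal{P}_i$ with edge set $\{\mathcal{E}(v)\mid v\in\mathcal{P}_{i+1}\}$ is a forest. An R-vine is a vine with $\operatorname{rk}(\mathcal{P})=\dim(\mathcal{P})$, each $F_i$ a tree, and proximity: distinct elements of the same rank $i\ge2$ covered by a common element cover a common element. An LR-vine is a vine all of whose principal ideals $\mathcal{P}_{\le v}$ (induced order and rank) are R-vines. For $a\in\mathcal{P}$, the complete union $U_a$ is the set of minimal elements $x$ of $\mathcal{P}$ with $x\le a$. -}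

module Defs where

open import Level using (0ℓ)
open import Data.Nat using (ℕ; zero; suc; _+_) renaming (_≤_ to _≤ℕ_; _<_ to _<ℕ_)
open import Data.Fin using (Fin)
open import Data.List using (List; []; _∷_; _++_; [_]; length)
open import Data.List.Relation.Unary.Linked using (Linked)
open import Data.List.Relation.Unary.Unique.Propositional using (Unique)
open import Data.Product using (Σ; ∃; ∃-syntax; _×_; _,_)
open import Data.Sum using (_⊎_)
open import Data.Unit using (⊤)
open import Data.Empty using (⊥)
open import Function.Definitions using (Injective)
open import Relation.Nullary using (¬_)
open import Relation.Binary using (Rel)
open import Relation.Binary.PropositionalEquality using (_≡_; _≢_)
open import Relation.Binary.Construct.Closure.ReflexiveTransitive using (Star)

-- A finite poset is modelled on the carrier Fin n with an order relation _≤_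
-- (assumed to be a partial order w.r.t. _≡_ in the statement).
-- All notions below are relative to a subset S of the carrier, equipped with
-- the induced order; S = everything gives the poset itself, and
-- S = (λ x → x ≤ v) gives the principal ideal P_{≤v}.
-- A rank function is rk : Fin n → ℕ (positivity is required in Graded).
module Vines {n : ℕ} (_≤_ : Rel (Fin n) 0ℓ) where

  Carrier : Set
  Carrier = Fin n

  Subset : Set₁
  Subset = Carrier → Set

  Whole : Subset
  Whole _ = ⊤

  Ideal : Carrier → Subset
  Ideal v x = x ≤ v

  _<_ : Rel Carrier 0ℓ
  x < y = x ≤ y × x ≢ y

  Minimal : Subset → Carrier → Set
  Minimal S x = S x × (∀ y → S y → y ≤ x → y ≡ x)

  Covers : Subset → Carrier → Carrier → Set
  Covers S y x = S x × S y × x < y × (∀ z → S z → x < z → z < y → ⊥)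

  Graded : Subset → (Carrier → ℕ) → Set
  Graded S rk =
      (∀ x → S x → 0 <ℕ rk x)
    × (∀ x y → S x → S y → x < y → rk x <ℕ rk y)
    × (∀ x y → Covers S y x → rk y ≡ suc (rk x))
    × (∀ x → Minimal S x → rk x ≡ 1)

  HasRank : Subset → (Carrier → ℕ) → ℕ → Set
  HasRank S rk r = (∃[ x ] (S x × rk x ≡ r)) × (∀ x → S x → rk x ≤ℕ r)

  HasDim : Subset → ℕ → Set
  HasDim S d = Σ (Fin d → Carrier) λ f →
      Injective _≡_ _≡_ f
    × (∀ k → Minimal S (f k))
    × (∀ x → Minimal S x → ∃[ k ] (f k ≡ x))

  -- the graph F_i on S_i : x — y iff {x , y} = E(v) for some v ∈ S_{i+1}
  Adj : Subset → (Carrier → ℕ) → ℕ → Rel Carrier 0ℓ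
  Adj S rk i x y =
    S x × S y × rk x ≡ i × rk y ≡ i × x ≢ y ×
    (∃[ v ] (S v × rk v ≡ suc i × Covers S v x × Covers S v y))

  HasCycle : Subset → (Carrier → ℕ) → ℕ → Set
  HasCycle S rk i = Σ Carrier λ x → Σ (List Carrier) λ xs →
      Unique (x ∷ xs) × 3 ≤ℕ length (x ∷ xs)
    × Linked (Adj S rk i) (x ∷ xs ++ [ x ])

  Forest : Subset → (Carrier → ℕ) → ℕ → Set
  Forest S rk i = ¬ HasCycle S rk i

  Connected : Subset → (Carrier → ℕ) → ℕ → Set
  Connected S rk i = ∀ x y → S x → S y → rk x ≡ i → rk y ≡ i → Star (Adj S rk i) x y

  Tree : Subset → (Carrier → ℕ) → ℕ → Set
  Tree S rk i = Forest S rk i × Connected S rk i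

  CoversTwo : Subset → Set
  CoversTwo S = ∀ v → S v → ¬ Minimal S v →
    ∃[ a ] ∃[ b ] (a ≢ b × Covers S v a × Covers S v b
                   × (∀ c → Covers S v c → c ≡ a ⊎ c ≡ b))

  AtMostOneCommonCover : Subset → (Carrier → ℕ) → Set
  AtMostOneCommonCover S rk = ∀ x y u w → x ≢ y → rk x ≡ rk y →
    Covers S u x → Covers S u y → Covers S w x → Covers S w y → u ≡ w

  IsVine : Subset → (Carrier → ℕ) → Set
  IsVine S rk =
      Graded S rk
    × CoversTwo S
    × AtMostOneCommonCover S rk
    × (∀ r → HasRank S rk r → ∀ i → 1 ≤ℕ i → i ≤ℕ r → Forest S rk i)

  Proximity : Subset → (Carrier → ℕ) → Set
  Proximity S rk = ∀ x y v → x ≢ y → rk x ≡ rk y → 2 ≤ℕ rk x →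
    Covers S v x → Covers S v y → ∃[ z ] (Covers S x z × Covers S y z)

  IsRVine : Subset → (Carrier → ℕ) → Set
  IsRVine S rk =
      IsVine S rk
    × (∀ r d → HasRank S rk r → HasDim S d → r ≡ d)
    × (∀ r → HasRank S rk r → ∀ i → 1 ≤ℕ i → i ≤ℕ r → Tree S rk i)
    × Proximity S rk

  IsLRVine : (Carrier → ℕ) → Set
  IsLRVine rk = IsVine Whole rk × (∀ v → IsRVine (Ideal v) rk)

  -- complete union U_a ⊆ U_b
  _⊆U_ : Carrier → Carrier → Set
  a ⊆U b = ∀ x → Minimal Whole x → x ≤ a → x ≤ b

{-# OPTIONS --safe #-}
module Submission where

-- Induction on the rank of a. A minimal a lies in U_a ⊆ U_b. Otherwise a covers
-- two elements a₁ ≠ a₂ with U_{aᵢ} ⊆ U_a ⊆ U_b, so aᵢ ≤ b by induction. Since F_i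
-- of the R-vine P_{≤b} is connected, a₁ and a₂ are joined by a simple path in it,
-- which is also a path in F_i of P. There a₁ and a₂ are adjacent through a, so
-- because F_i of P is a forest the path is the single edge a₁ — a₂, witnessed by
-- a common cover v ≤ b. Two elements of equal rank have at most one common cover,
-- hence a = v ≤ b.

open import Defs
open import Level using (0ℓ; _⊔_)
open import Data.Nat using (ℕ; suc; z≤n; s≤s) renaming (_≤_ to _≤ℕ_; _<_ to _<ℕ_)
open import Data.Nat.Induction using (<-wellFounded)
open import Data.Nat.Properties using (≤-refl; ≤-reflexive; <⇒≤; ≤-<-trans; <-irrefl; suc-injective)
  renaming (_≟_ to _≟ℕ_)
open import Data.Fin using (Fin)
open import Data.Fin.Properties using (_≟_)
open import Data.List using (List; []; _∷_; _++_; [_]; allFin)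
open import Data.List.Extrema.Nat using (argmax; f[xs]≤f[argmax])
open import Data.List.Membership.Propositional using (_∈_)
open import Data.List.Membership.Propositional.Properties using (∈-allFin)
open import Data.List.Relation.Unary.All using (All; []; lookup)
open import Data.List.Relation.Unary.All.Properties.Core using (¬Any⇒All¬)
open import Data.List.Relation.Unary.AllPairs using ([]; _∷_)
open import Data.List.Relation.Unary.Any using (here; there)
open import Data.List.Relation.Unary.Linked as Linked using (Linked; [-]; _∷_)
open import Data.List.Relation.Unary.Unique.Propositional using (Unique)
open import Data.Product using (∃-syntax; _×_; _,_; proj₁; proj₂)
open import Data.Unit using (⊤; tt)
open import Data.Empty using (⊥-elim)
open import Function using (_∘_; _on_)
open import Induction.WellFounded using (Acc; acc)
open import Relation.Binary using (Rel; IsPartialOrder; DecidableEquality; _⇒_)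
open import Relation.Binary.Construct.On using (wellFounded)
open import Relation.Binary.Construct.Closure.ReflexiveTransitive using (Star; ε; _◅_)
open import Relation.Binary.PropositionalEquality using (_≡_; _≢_; refl; sym; trans; subst)
open import Relation.Nullary using (yes; no)

endOf : ∀ {a} {A : Set a} → A → List A → A
endOf x []       = x
endOf x (y ∷ ys) = endOf y ys

module SimplePaths {a ℓ} {A : Set a} (R : Rel A ℓ) where

  record SimplePath (x y : A) : Set (a ⊔ ℓ) where
    constructor simplePath
    field
      rest   : List A
      unique : Unique (x ∷ rest)
      linked : Linked R (x ∷ rest)
      ends   : endOf x rest ≡ y

  suffixFrom : ∀ {x h y} t → x ∈ h ∷ t → Unique (h ∷ t) → Linked R (h ∷ t) →
               endOf h t ≡ y → SimplePath x y
  suffixFrom t       (here refl) u       l       e = simplePath t u l e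
  suffixFrom (_ ∷ t) (there x∈t) (_ ∷ u) (_ ∷ l) e = suffixFrom t x∈t u l e

  linked-∷ʳ : ∀ {x z} t → Linked R (x ∷ t) → R (endOf x t) z → Linked R (x ∷ t ++ [ z ])
  linked-∷ʳ []      [-]      r = r ∷ [-]
  linked-∷ʳ (_ ∷ t) (r′ ∷ l) r = r′ ∷ linked-∷ʳ t l r

  module _ (_≟A_ : DecidableEquality A) where
    open import Data.List.Membership.DecPropositional _≟A_ using (_∈?_)

    star⇒simplePath : ∀ {x y} → Star R x y → SimplePath x y
    star⇒simplePath ε = simplePath [] ([] ∷ []) [-] refl
    star⇒simplePath {x} (_◅_ {j = x′} r s) with star⇒simplePath s
    ... | simplePath t u l e with x ∈? x′ ∷ t
    ...   | yes x∈ = suffixFrom t x∈ u l e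
    ...   | no x∉ = simplePath (x′ ∷ t) (¬Any⇒All¬ (x′ ∷ t) x∉ ∷ u) (r ∷ l) e

open SimplePaths using (SimplePath; simplePath; linked-∷ʳ; star⇒simplePath)

hasRank-whole : ∀ {n} (_≤_ : Rel (Fin n) 0ℓ) (rk : Fin n → ℕ) → Fin n →
                ∃[ r ] Vines.HasRank _≤_ (Vines.Whole _≤_) rk r
hasRank-whole {n} _≤_ rk x = rk top , (top , tt , refl) , λ y _ → lookup maximal (∈-allFin y)
  where
  top : Fin n
  top = argmax rk x (allFin n)

  maximal : All (λ y → rk y ≤ℕ rk top) (allFin n)
  maximal = f[xs]≤f[argmax] x (allFin n)

module _ {n : ℕ} {_≤_ : Rel (Fin n) 0ℓ} (po : IsPartialOrder _≡_ _≤_) where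
  open Vines _≤_
  private module ≤ = IsPartialOrder po

  covers-ideal⇒covers : ∀ {b u x} → Covers (Ideal b) u x → Covers Whole u x
  covers-ideal⇒covers (_ , u≤b , x<u , nothing-between) =
    tt , tt , x<u , λ z _ x<z z<u → nothing-between z (≤.trans (proj₁ z<u) u≤b) x<z z<u

  adj-ideal⇒adj : ∀ {b rk i} → Adj (Ideal b) rk i ⇒ Adj Whole rk i
  adj-ideal⇒adj (_ , _ , rx , ry , x≢y , v , _ , rv , v⋗x , v⋗y) =
    tt , tt , rx , ry , x≢y , v , tt , rv , covers-ideal⇒covers v⋗x , covers-ideal⇒covers v⋗y

  covers⇒≤ : ∀ {S u x} → Covers S u x → x ≤ u
  covers⇒≤ (_ , _ , (x≤u , _) , _) = x≤u

  ⊆U-downward : ∀ {x a b} → x ≤ a → a ⊆U b → x ⊆U b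
  ⊆U-downward x≤a a⊆b m min m≤x = a⊆b m min (≤.trans m≤x x≤a)

  module _ {rk : Fin n → ℕ} (graded : Graded Whole rk) where
    private
      strictlyMonotone : ∀ x y → x < y → rk x <ℕ rk y
      strictlyMonotone x y = proj₁ (proj₂ graded) x y tt tt

      positive : ∀ x → 0 <ℕ rk x
      positive x = proj₁ graded x tt

    ideal-hasRank : ∀ b → HasRank (Ideal b) rk (rk b)
    ideal-hasRank b = (b , ≤.refl , refl) , below
      where
      below : ∀ x → x ≤ b → rk x ≤ℕ rk b
      below x x≤b with x ≟ b
      ... | yes refl = ≤-refl
      ... | no x≢b  = <⇒≤ (strictlyMonotone x b (x≤b , x≢b))

    rank≡1⇒minimal : ∀ a → rk a ≡ 1 → Minimal Whole a
    rank≡1⇒minimal a rk≡1 = tt , below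
      where
      below : ∀ y → ⊤ → y ≤ a → y ≡ a
      below y _ y≤a with y ≟ a
      ... | yes y≡a = y≡a
      ... | no y≢a = ⊥-elim (<-irrefl (sym rk≡1) (≤-<-trans (positive y) (strictlyMonotone y a (y≤a , y≢a))))

  lrVine⇒ideals-connected : ∀ {rk} → IsLRVine rk →
                            ∀ b i → 1 ≤ℕ i → i ≤ℕ rk b → Connected (Ideal b) rk i
  lrVine⇒ideals-connected {rk} ((graded , _) , ideal-rVine) b i 1≤i i≤rk =
    proj₂ (ideal-trees (rk b) (ideal-hasRank graded b) i 1≤i i≤rk)
    where
    ideal-trees : ∀ r → HasRank (Ideal b) rk r → ∀ i → 1 ≤ℕ i → i ≤ℕ r → Tree (Ideal b) rk i
    ideal-trees = proj₁ (proj₂ (proj₂ (ideal-rVine b)))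

  module _ {rk : Fin n → ℕ} (vine : IsVine Whole rk)
           (ideals-connected : ∀ b i → 1 ≤ℕ i → i ≤ℕ rk b → Connected (Ideal b) rk i) where
    private
      graded : Graded Whole rk
      graded = proj₁ vine

      positive : ∀ x → 0 <ℕ rk x
      positive x = proj₁ graded x tt

      minimal-rank : ∀ x → Minimal Whole x → rk x ≡ 1
      minimal-rank = proj₂ (proj₂ (proj₂ graded))

      cover-rank : ∀ {a x} → Covers Whole a x → rk a ≡ suc (rk x)
      cover-rank {a} {x} = proj₁ (proj₂ (proj₂ graded)) x a

      coversTwo : CoversTwo Whole
      coversTwo = proj₁ (proj₂ vine)

      atMostOneCommonCover : AtMostOneCommonCover Whole rk
      atMostOneCommonCover = proj₁ (proj₂ (proj₂ vine))

    forest : ∀ x → Forest Whole rk (rk x)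
    forest x with hasRank-whole _≤_ rk x
    ... | r , rank = proj₂ (proj₂ (proj₂ vine)) r rank (rk x) (positive x) (proj₂ rank x tt)

    -- A longer simple path from x to y would close a cycle with the edge y — x.
    simplePath⇒adj : ∀ {b x y} → x ≢ y → Adj Whole rk (rk x) y x →
                     SimplePath (Adj (Ideal b) rk (rk x)) x y → Adj (Ideal b) rk (rk x) x y
    simplePath⇒adj x≢y _ (simplePath [] _ _ x≡y) = ⊥-elim (x≢y x≡y)
    simplePath⇒adj _ _ (simplePath (_ ∷ []) _ (x—y ∷ [-]) refl) = x—y
    simplePath⇒adj {x = x} _ y—x (simplePath (z ∷ w ∷ t) u l e) =
      ⊥-elim (forest x (x , z ∷ w ∷ t , u , s≤s (s≤s (s≤s z≤n)) , cycle))
      where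
      cycle : Linked (Adj Whole rk (rk x)) (x ∷ (z ∷ w ∷ t) ++ [ x ])
      cycle = linked-∷ʳ (Adj Whole rk (rk x)) (z ∷ w ∷ t) (Linked.map adj-ideal⇒adj l)
                (subst (λ q → Adj Whole rk (rk x) q x) (sym e) y—x)

    common-cover-below : ∀ {a a₁ a₂ b i} → a₁ ≢ a₂ → Covers Whole a a₁ → Covers Whole a a₂ →
                         Adj (Ideal b) rk i a₁ a₂ → a ≤ b
    common-cover-below {b = b} a₁≢a₂ a⋗a₁ a⋗a₂ (_ , _ , r₁ , r₂ , _ , v , v≤b , _ , v⋗a₁ , v⋗a₂) =
      subst (_≤ b) (atMostOneCommonCover _ _ v _ a₁≢a₂ (trans r₁ (sym r₂))
                      (covers-ideal⇒covers v⋗a₁) (covers-ideal⇒covers v⋗a₂) a⋗a₁ a⋗a₂) v≤b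

    covered-pair-below : ∀ {a a₁ a₂ b} → a₁ ≢ a₂ → Covers Whole a a₁ → Covers Whole a a₂ →
                         a₁ ≤ b → a₂ ≤ b → a ≤ b
    covered-pair-below {a} {a₁} {a₂} {b} a₁≢a₂ a⋗a₁ a⋗a₂ a₁≤b a₂≤b =
      common-cover-below a₁≢a₂ a⋗a₁ a⋗a₂ (simplePath⇒adj a₁≢a₂ a₂—a₁ path)
      where
      same-rank : rk a₁ ≡ rk a₂
      same-rank = suc-injective (trans (sym (cover-rank a⋗a₁)) (cover-rank a⋗a₂))

      a₂—a₁ : Adj Whole rk (rk a₁) a₂ a₁
      a₂—a₁ = tt , tt , sym same-rank , refl , a₁≢a₂ ∘ sym , a , tt , cover-rank a⋗a₁ , a⋗a₂ , a⋗a₁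

      path : SimplePath (Adj (Ideal b) rk (rk a₁)) a₁ a₂
      path = star⇒simplePath _ _≟_
        (ideals-connected b (rk a₁) (positive a₁) (proj₂ (ideal-hasRank graded b) a₁ a₁≤b)
           a₁ a₂ a₁≤b a₂≤b refl (sym same-rank))

    ⊆U⇒≤-acc : ∀ {b} a → Acc (_<ℕ_ on rk) a → a ⊆U b → a ≤ b
    ⊆U⇒≤-acc {b} a (acc smaller) a⊆b with rk a ≟ℕ 1
    ... | yes rk≡1 = a⊆b a (rank≡1⇒minimal graded a rk≡1) ≤.refl
    ... | no rk≢1 with coversTwo a tt (rk≢1 ∘ minimal-rank a)
    ...   | a₁ , a₂ , a₁≢a₂ , a⋗a₁ , a⋗a₂ , _ =
            covered-pair-below a₁≢a₂ a⋗a₁ a⋗a₂ (covered-below a⋗a₁) (covered-below a⋗a₂)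
      where
      covered-below : ∀ {x} → Covers Whole a x → x ≤ b
      covered-below a⋗x = ⊆U⇒≤-acc _ (smaller (≤-reflexive (sym (cover-rank a⋗x))))
                            (⊆U-downward (covers⇒≤ a⋗x) a⊆b)

    ⊆U⇒≤ : ∀ {a b} → a ⊆U b → a ≤ b
    ⊆U⇒≤ {a} = ⊆U⇒≤-acc a (wellFounded rk <-wellFounded a)

corollary4p6 : (n : ℕ) (_≤_ : Rel (Fin n) 0ℓ) → IsPartialOrder _≡_ _≤_ →
    (rk : Fin n → ℕ) → Vines.IsLRVine _≤_ rk → (a b : Fin n) →
    (Vines._⊆U_ _≤_ a b → a ≤ b)
    × (Vines._⊆U_ _≤_ a b → Vines._⊆U_ _≤_ b a → a ≡ b)
corollary4p6 n _≤_ po rk lr a b = ⊆U⇒≤′ , λ a⊆b b⊆a → IsPartialOrder.antisym po (⊆U⇒≤′ a⊆b) (⊆U⇒≤′ b⊆a)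
  where
  ⊆U⇒≤′ : ∀ {x y} → Vines._⊆U_ _≤_ x y → x ≤ y
  ⊆U⇒≤′ = ⊆U⇒≤ po (proj₁ lr) (lrVine⇒ideals-connected po lr)
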